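{- Let $k \geq 2$ and let $\mathcal{A} = (S, s_0, \delta, \tau)$ be a finite $k$-automaton. There exists a threshold $p_3$ such that for every prime $p > p_3$ there exists a pair $n_1, n_2 \in \mathbb{N}_0$ with $n_1 \not\equiv n_2 \pmod p$ such that $n_1 \sim n_2$ and $p n_1 \sim p n_2$.
   Context: $\Sigma_k=\{0,\dots,k-1\}$; $\Sigma_k^*$ is the set of finite words over $\Sigma_k$. The automaton consists of a finite set $S$, $s_0\in S$, a map $\delta\colon\Sigma_k\times S\to S$, $(j,s)\mapsto\delta_j(s)$, extended to words by $\delta_{uv}=\delta_u\circ\delta_v$, and $\tau\colon S\to\mathbb{C}$. For $n\in\mathbb{N}_0$ and $l\in\mathbb{N}_0$, $(n)_k^l$ denotes the length-$l$ suffix of the infinite-to-the-left word $0^\infty (n)_k$, where $(n)_k$ is the base-$k$ expansion of $n$ without leading zeros. For words, $u\sim v$ means $|u|=|v|$ and $\delta_u=\delta_v$. For $n_1,n_2\in\mathbb{N}_0$, $n_1\sim n_2$ means $(n_1)_k^l\sim(n_2)_k^l$ for all sufficiently large $l\in\mathbb{N}$. -}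

module Defs where

open import Data.Nat using (ℕ; zero; suc; _+_; _*_; _≤_; _<_; NonZero)
open import Data.Nat.DivMod using (_/_; _%_; _mod_)
open import Data.Nat.Primality using (Prime; prime⇒nonZero)
open import Data.Fin using (Fin)
open import Data.List using (List; []; _∷_; _++_; [_]; length)
open import Data.Product using (_×_; ∃-syntax)
open import Function using (id; _∘_)
open import Relation.Binary.PropositionalEquality using (_≡_)

record Automaton (k : ℕ) (Out : Set) : Set where
  field
    size : ℕ
    s₀   : Fin size
    δ    : Fin k → Fin size → Fin size
    τ    : Fin size → Out

module _ {k : ℕ} {Out : Set} (A : Automaton k Out) where
  open Automaton A

  δw : List (Fin k) → Fin size → Fin size
  δw []      = id
  δw (j ∷ u) = δ j ∘ δw u

  _∼w_ : List (Fin k) → List (Fin k) → Set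
  u ∼w v = (length u ≡ length v) × (∀ s → δw u s ≡ δw v s)

-- (n)_k^l : length-l suffix of 0^∞ (n)_k, most significant digit first
digits : (k : ℕ) .{{_ : NonZero k}} → ℕ → ℕ → List (Fin k)
digits k zero    n = []
digits k (suc l) n = digits k l (n / k) ++ [ n mod k ]

_∼[_]_ : {k : ℕ} {Out : Set} .{{_ : NonZero k}} → ℕ → Automaton k Out → ℕ → Set
_∼[_]_ {k} n₁ A n₂ = ∃[ L ] (∀ l → L ≤ l → _∼w_ A (digits k l n₁) (digits k l n₂))

CongMod : {p : ℕ} → Prime p → ℕ → ℕ → Set
CongMod {p} pr a b = let instance _ = prime⇒nonZero pr in a % p ≡ b % p

{-# OPTIONS --safe #-}
module Submission where

-- Assign to each residue x < p the pair of transition maps of the length-M words of x and p x.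
-- There are at most (|S|^|S|)² such pairs, so once p exceeds this number two residues
-- share a pair.  Taking M ≥ p², every later digit of x and p x is a leading zero, so the
-- longer words differ from the length-M ones by a common prefix of zeros, and the
-- agreement persists for all larger lengths.

open import Defs
open import Data.Nat using (ℕ; zero; suc; _+_; _∸_; _^_; _*_; _≤_; _<_; NonZero; z≤n)
open import Data.Nat.Properties
  using (m<1+n⇒m≤n; <-≤-trans; <⇒≤; ≤-trans; m≤m*n; *-monoʳ-≤; m∸n+n≡m; +-comm; <-irrefl)
open import Data.Nat.DivMod using (_/_; _mod_; m/n<m; m/n≤m; m<n⇒m%n≡m)
open import Data.Nat.Primality using (Prime; prime⇒nonZero)
open import Data.Fin using (Fin; toℕ; combine; funToFin; finToFun)
open import Data.Fin.Properties using (toℕ<n; combine-injective; finToFun-funToFin; pigeonhole)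
open import Data.List using (List; []; _∷_; _++_; [_]; length)
open import Data.List.Properties using (length-++; ++-assoc; ++-identityʳ)
open import Data.Product using (_×_; ∃-syntax; _,_)
open import Relation.Nullary using (¬_)
open import Relation.Binary.PropositionalEquality using (_≡_; refl; sym; trans; cong; subst; module ≡-Reasoning)
open import Function using (_∘_)

module _ {k : ℕ} {Out : Set} (A : Automaton k Out) where
  open Automaton A

  δw-++ : ∀ u v s → δw A (u ++ v) s ≡ δw A u (δw A v s)
  δw-++ []      v s = refl
  δw-++ (j ∷ u) v s = cong (δ j) (δw-++ u v s)

  ∼w-++ˡ : ∀ w {u v} → _∼w_ A u v → _∼w_ A (w ++ u) (w ++ v)
  ∼w-++ˡ w {u} {v} (|u|≡|v| , δu≗δv) = |wu|≡|wv| , δwu≗δwv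
    where
    |wu|≡|wv| : length (w ++ u) ≡ length (w ++ v)
    |wu|≡|wv| = trans (length-++ w) (trans (cong (length w +_) |u|≡|v|) (sym (length-++ w)))

    δwu≗δwv : ∀ s → δw A (w ++ u) s ≡ δw A (w ++ v) s
    δwu≗δwv s = begin
      δw A (w ++ u) s     ≡⟨ δw-++ w u s ⟩
      δw A w (δw A u s)   ≡⟨ cong (δw A w) (δu≗δv s) ⟩
      δw A w (δw A v s)   ≡⟨ δw-++ w v s ⟨
      δw A (w ++ v) s     ∎
      where open ≡-Reasoning

  profile : List (Fin k) → Fin (size ^ size)
  profile = funToFin ∘ δw A

  profile-injective : ∀ u v → profile u ≡ profile v → ∀ s → δw A u s ≡ δw A v s
  profile-injective u v eq s = begin
    δw A u s                    ≡⟨ finToFun-funToFin (δw A u) s ⟨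
    finToFun (profile u) s      ≡⟨ cong (λ i → finToFun i s) eq ⟩
    finToFun (profile v) s      ≡⟨ finToFun-funToFin (δw A v) s ⟩
    δw A v s                    ∎
    where open ≡-Reasoning

module _ (k : ℕ) .{{_ : NonZero k}} where

  length-digits : ∀ l n → length (digits k l n) ≡ l
  length-digits zero    n = refl
  length-digits (suc l) n =
    trans (length-++ (digits k l (n / k))) (trans (cong (_+ 1) (length-digits l (n / k))) (+-comm l 1))

  module _ (2≤k : 2 ≤ k) where

    /-≤-pred : ∀ {n M} → n ≤ suc M → n / k ≤ M
    /-≤-pred {zero}  _     = ≤-trans (m/n≤m 0 k) z≤n
    /-≤-pred {suc n} n≤1+M = m<1+n⇒m≤n (<-≤-trans (m/n<m (suc n) k 2≤k) n≤1+M)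

    -- Since dividing by k ≥ 2 lowers every positive number, n ≤ M has at most M digits.
    digits-+-padding : ∀ a M n → n ≤ M → digits k (a + M) n ≡ digits k a 0 ++ digits k M n
    digits-+-padding a zero n z≤n rewrite +-comm a 0 = sym (++-identityʳ (digits k a 0))
    digits-+-padding a (suc M) n n≤1+M rewrite +-comm a (suc M) | +-comm M a = begin
      digits k (a + M) (n / k) ++ [ n mod k ]              ≡⟨ cong (_++ [ n mod k ]) (digits-+-padding a M (n / k) (/-≤-pred n≤1+M)) ⟩
      (digits k a 0 ++ digits k M (n / k)) ++ [ n mod k ]  ≡⟨ ++-assoc (digits k a 0) (digits k M (n / k)) [ n mod k ] ⟩
      digits k a 0 ++ digits k (suc M) n                   ∎
      where open ≡-Reasoning

    ∼-from-digits : {Out : Set} (A : Automaton k Out) → ∀ M {n₁ n₂} → n₁ ≤ M → n₂ ≤ M →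
                    (∀ s → δw A (digits k M n₁) s ≡ δw A (digits k M n₂) s) → n₁ ∼[ A ] n₂
    ∼-from-digits A M {n₁} {n₂} n₁≤M n₂≤M δ≗ = M , λ l M≤l →
      subst (λ l → _∼w_ A (digits k l n₁) (digits k l n₂)) (m∸n+n≡m M≤l) (∼w-at (l ∸ M))
      where
      window : _∼w_ A (digits k M n₁) (digits k M n₂)
      window = trans (length-digits M n₁) (sym (length-digits M n₂)) , δ≗

      ∼w-at : ∀ a → _∼w_ A (digits k (a + M) n₁) (digits k (a + M) n₂)
      ∼w-at a rewrite digits-+-padding a M n₁ n₁≤M | digits-+-padding a M n₂ n₂≤M =
        ∼w-++ˡ A (digits k a 0) window

distinct-residues : ∀ {p} (pr : Prime p) {i j : Fin p} → toℕ i < toℕ j → ¬ CongMod pr (toℕ i) (toℕ j)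
distinct-residues {p} pr {i} {j} i<j i%p≡j%p = <-irrefl i≡j i<j
  where
  instance _ = prime⇒nonZero pr
  i≡j : toℕ i ≡ toℕ j
  i≡j = trans (sym (m<n⇒m%n≡m (toℕ<n i))) (trans i%p≡j%p (m<n⇒m%n≡m (toℕ<n j)))

lemma3p3 : (k : ℕ) .{{_ : NonZero k}} → 2 ≤ k → {Out : Set} → (A : Automaton k Out) →
    ∃[ p₃ ] (∀ p → (pr : Prime p) → p₃ < p →
      ∃[ n₁ ] ∃[ n₂ ] (¬ CongMod pr n₁ n₂ × n₁ ∼[ A ] n₂ × (p * n₁) ∼[ A ] (p * n₂)))
lemma3p3 k 2≤k A = T * T , collision
  where
  open Automaton A
  T = size ^ size

  module Window (p : ℕ) (pr : Prime p) where
    M = p * p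

    word multiple : Fin p → List (Fin k)
    word x = digits k M (toℕ x)
    multiple x = digits k M (p * toℕ x)

    profiles : Fin p → Fin (T * T)
    profiles x = combine (profile A (word x)) (profile A (multiple x))

    x≤M : (x : Fin p) → toℕ x ≤ M
    x≤M x = ≤-trans (<⇒≤ (toℕ<n x)) (m≤m*n p p {{prime⇒nonZero pr}})

    px≤M : (x : Fin p) → p * toℕ x ≤ M
    px≤M x = *-monoʳ-≤ p (<⇒≤ (toℕ<n x))

  collision : ∀ p → (pr : Prime p) → T * T < p →
    ∃[ n₁ ] ∃[ n₂ ] (¬ CongMod pr n₁ n₂ × n₁ ∼[ A ] n₂ × (p * n₁) ∼[ A ] (p * n₂))
  collision p pr T²<p with i , j , i<j , same ← pigeonhole T²<p (Window.profiles p pr)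
                      with x≡ , px≡ ← combine-injective _ _ _ _ same =
    toℕ i , toℕ j , distinct-residues pr i<j ,
    ∼-from-digits k 2≤k A M (x≤M i) (x≤M j) (profile-injective A (word i) (word j) x≡) ,
    ∼-from-digits k 2≤k A M (px≤M i) (px≤M j) (profile-injective A (multiple i) (multiple j) px≡)
    where open Window p pr
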